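{- Let $\Psi=\exists^{\geq\beta(v_1)}v_1\cdots\exists^{\geq\beta(v_n)}v_n\bigwedge_{v_iv_k\in E(G)}E(v_i,v_k)$ be an instance of $\{1,2\}$-CSP$(\mathbf{P}_\infty)$ with graph $G$, order $\prec$ and $\beta:V(G)\to\{1,2\}$, and suppose $G$ is bipartite. Then the following are equivalent: (I) $\mathbf{P}_\infty \models \Psi$; (II) Prover has a winning strategy in the game $\mathscr{G}(\Psi,\mathbf{P}_\infty)$; (III) Prover can play $\mathscr{G}(\Psi,\mathbf{P}_\infty)$ so that in every play the resulting mapping $f:V(G)\to\mathbb{Z}$ satisfies, for all $u,v\in V(G)$ with $\delta(u,v)<\infty$, both $|f(u)-f(v)|\leq \delta(u,v)$ and that $f(u)+f(v)+\delta(u,v)$ is even; (IV) there are no $u,v\in V(G)$ with $u\prec v$ and $\delta(u,v)\leq \beta(v)-2$; (V) there is no bad walk in $G$.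
   Context: $\mathbf{P}_\infty$ is the graph with vertex set $\mathbb{Z}$ and edges $\{i,k\}$ with $|i-k|=1$. An instance of $\{1,2\}$-CSP$(\mathbf{P}_\infty)$ is a sentence in which each variable $v$ is quantified by $\exists^{\geq \beta(v)}$, $\beta(v)\in\{1,2\}$ ($\exists^{\geq j}$: at least $j$ distinct elements), followed by a conjunction of atoms $E(v_i,v_k)$; $G$ is the graph on the variables with an edge $v_iv_k$ for each atom, and $\prec$ is the quantification order. For sets, $X\prec Y$ means $x\prec y$ for all $x\in X,y\in Y$. Game $\mathscr{G}(\Psi,\mathbf{P}_\infty)$: going through the variables in order $\prec$, for variable $v$ Prover offers a set of $\beta(v)$ distinct integers and Adversary picks one of them as $f(v)$; Prover wins if $f$ is a homomorphism $G\to\mathbf{P}_\infty$. A walk $x_1,\ldots,x_r$ has length $|Q|=r-1$ and $\lambda(Q)=|Q|-2\sum_{i=2}^{r-1}(\beta(x_i)-1)$. Looping walks are defined recursively: a walk $x_1,\ldots,x_r$ is looping if $x_1\neq x_r$ and, when $r\geq 3$, (i) $\{x_1,x_r\}\prec\{x_2,\ldots,x_{r-1}\}$ and (ii) there is $\ell\notin\{1,r\}$ such that both $x_1,\ldots,x_\ell$ and $x_\ell,\ldots,x_r$ are looping walks (for $r=2$, a looping walk is just two distinct adjacent vertices). $\delta(u,v)$ is the minimum of $\lambda(Q)$ over looping walks $Q$ with endpoints $u$ and $v$ (in either order), and $\delta(u,v)=\infty$ if none exists. A bad walk is a looping walk $Q=x_1,\ldots,x_r$ with $x_1\prec x_r$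 and $\lambda(Q)\leq \beta(x_r)-2$. -}

module Defs where

open import Data.Nat as ℕ using (ℕ; _∸_)
open import Data.Integer as ℤ using (ℤ; +_; _-_; _≤_; ∣_∣; _+_)
open import Data.Integer.Divisibility using (_∣_)
open import Data.Fin using (Fin; _<_; _≟_)
open import Data.List using (List; []; _∷_; _++_; length; map; allFin)
open import Data.Nat.ListAction using (sum)
open import Data.List.Membership.Propositional using (_∈_)
open import Data.List.Relation.Unary.All using (All)
open import Data.List.Relation.Unary.Unique.Propositional using (Unique)
open import Data.Product using (Σ; ∃; _×_; _,_)
open import Data.Sum using (_⊎_)
open import Data.Bool using (Bool; if_then_else_)
open import Relation.Nullary using (¬_)
open import Relation.Nullary.Decidable using (⌊_⌋)
open import Relation.Binary.PropositionalEquality using (_≡_; _≢_)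

-- The graph G of an instance on variables v_1..v_n (encoded as Fin n) is
-- given by its list of atoms E(v_i , v_k).  The quantification order ≺ is
-- the order of Fin n (v_1 ≺ v_2 ≺ ... ≺ v_n).

Bipartite : (n : ℕ) → List (Fin n × Fin n) → Set
Bipartite n atoms = Σ (Fin n → Bool) λ c → ∀ {u v} → (u , v) ∈ atoms → c u ≢ c v

module Instance (n : ℕ) (atoms : List (Fin n × Fin n)) (β : Fin n → ℕ) where

  V : Set
  V = Fin n

  Adj : V → V → Set
  Adj u v = ((u , v) ∈ atoms) ⊎ ((v , u) ∈ atoms)

  Hom : (V → ℤ) → Set
  Hom f = ∀ {u v} → (u , v) ∈ atoms → ∣ f u - f v ∣ ≡ 1

  _[_↦_] : (V → ℤ) → V → ℤ → (V → ℤ)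
  (f [ v ↦ z ]) w = if ⌊ w ≟ v ⌋ then z else f w

  vars : List V
  vars = allFin n

  -- initial (empty) assignment; its values are never read
  f₀ : V → ℤ
  f₀ _ = + 0

  ExistsAtLeast : ℕ → (ℤ → Set) → Set
  ExistsAtLeast j P = Σ (List ℤ) λ zs → (length zs ≡ j) × Unique zs × All P zs

  Sat : List V → (V → ℤ) → Set
  Sat [] f = Hom f
  Sat (v ∷ vs) f = ExistsAtLeast (β v) (λ z → Sat vs (f [ v ↦ z ]))

  Models : Set
  Models = Sat vars f₀

  -- (II)/(III) the game 𝒢(Ψ, P∞)
  -- A Prover strategy: at variable v, seeing the values chosen so far
  -- (later variables still carry the initial value), offer a list of integers.
  Strategy : Set
  Strategy = V → (V → ℤ) → List ℤ

  Legal : Strategy → Set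
  Legal σ = ∀ v h → (length (σ v h) ≡ β v) × Unique (σ v h)

  -- Play σ vs f g : starting from partial assignment f, playing the
  -- variables vs in order against σ, Adversary's picks lead to final g.
  data Play (σ : Strategy) : List V → (V → ℤ) → (V → ℤ) → Set where
    done : ∀ {f} → Play σ [] f f
    step : ∀ {v vs f g z} → z ∈ σ v f → Play σ vs (f [ v ↦ z ]) g →
           Play σ (v ∷ vs) f g

  ProverCanEnsure : ((V → ℤ) → Set) → Set
  ProverCanEnsure P = Σ Strategy λ σ → Legal σ × (∀ g → Play σ vars f₀ g → P g)

  ProverWins : Set
  ProverWins = ProverCanEnsure Hom

  -- walks and looping walks.  Looping a is b : the walk a, is..., b
  -- (is = interior vertices) is looping.
  Interior< : V → V → List V → Set
  Interior< a b is = All (λ x → (a < x) × (b < x)) is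

  data Looping : V → List V → V → Set where
    edge : ∀ {a b} → a ≢ b → Adj a b → Looping a [] b
    comb : ∀ {a b m ys zs} → a ≢ b → Interior< a b (ys ++ m ∷ zs) →
           Looping a ys m → Looping m zs b → Looping a (ys ++ m ∷ zs) b

  λw : List V → ℤ
  λw is = + (ℕ.suc (length is)) - + (2 ℕ.* sum (map (λ x → β x ∸ 1) is))

  LoopVal : V → V → ℤ → Set
  LoopVal u v d = Σ (List V) λ is → (Looping u is v ⊎ Looping v is u) × (λw is ≡ d)

  IsDelta : V → V → ℤ → Set
  IsDelta u v d = LoopVal u v d × (∀ d' → LoopVal u v d' → d ≤ d')

  DeltaCond : (V → ℤ) → Set
  DeltaCond f = ∀ u v d → IsDelta u v d →
                (+ ∣ f u - f v ∣ ≤ d) × (+ 2 ∣ (f u + f v + d))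

  NoSmallDelta : Set
  NoSmallDelta = ¬ (Σ V λ u → Σ V λ v → Σ ℤ λ d →
                      (u < v) × IsDelta u v d × (d ≤ + β v - + 2))

  BadWalk : Set
  BadWalk = Σ V λ a → Σ (List V) λ is → Σ V λ b →
              Looping a is b × (a < b) × (λw is ≤ + β b - + 2)

module Submission where

open import Defs
open import Data.Nat as ℕ using (ℕ; zero; suc; _∸_)
import Data.Nat.Properties as ℕP
open import Data.Nat.ListAction using (sum)
open import Data.Nat.ListAction.Properties using (sum-++)
open import Data.Integer as ℤ using (ℤ; +_; -[1+_]; _-_; _+_; _*_; -_; ∣_∣; _≤_; +≤+; -≤+; +<+; 0ℤ)
import Data.Integer.Properties as ℤP
open import Data.Integer.Divisibility.Signed as Signed using (divides; ∣m∣n⇒∣m+n; ∣m∣n⇒∣m-n; ∣ᵤ⇒∣; ∣⇒∣ᵤ)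
open import Data.Integer.Tactic.RingSolver using (solve-∀)
open import Data.Fin as F using (Fin; toℕ; _≟_)
import Data.Fin.Properties as FP
open import Data.List
  using (List; []; _∷_; [_]; _++_; length; map; allFin; filter; concatMap; cartesianProductWith;
         applyUpTo; tabulate)
import Data.List.Properties as LP
open import Data.List.Membership.Propositional using (_∈_; find; lose)
open import Data.List.Membership.Propositional.Properties
  using (∈-++⁺ʳ; ∈-++⁻; ∈-filter⁺; ∈-filter⁻; ∈-allFin; ∈-concatMap⁺; ∈-concatMap⁻; ∈-map⁺; ∈-map⁻;
         ∈-applyUpTo⁻; ∈-cartesianProductWith⁺; ∈-cartesianProductWith⁻)
import Data.List.Membership.DecPropositional as DecMembership
open import Data.List.Relation.Unary.Any as Any using (Any; here; there)
open import Data.List.Relation.Unary.All as All using (All; []; _∷_)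
import Data.List.Relation.Unary.All.Properties as AllP
open import Data.List.Relation.Unary.AllPairs using (_∷_)
open import Data.List.Relation.Unary.Unique.Propositional using (Unique)
open import Data.List.Relation.Unary.Unique.Propositional.Properties using (applyUpTo⁺₁)
import Data.List.Extrema ℤP.≤-totalOrder as Extrema
open import Data.Product using (Σ-syntax; _×_; _,_; proj₁; proj₂)
import Data.Product.Properties as ×P
open import Data.Sum using (_⊎_; inj₁; inj₂)
open import Data.Bool using (true; false; if_then_else_)
open import Data.Empty using (⊥; ⊥-elim)
open import Function using (_∋_; _∘_)
open import Function.Bundles using (_⇔_; mk⇔; Equivalence)
open import Relation.Nullary using (¬_; Dec; yes; no; ¬?)
open import Relation.Nullary.Decidable using (_×-dec_; _⊎-dec_; map′)
open import Relation.Unary using (Decidable)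
open import Relation.Binary.PropositionalEquality
  using (_≡_; _≢_; refl; sym; trans; cong; subst; module ≡-Reasoning)

-- Call integers x, y d-compatible when |x − y| ≤ d and x + y + d is even.  The λ-values of the
-- looping walks between a and b form a finite list Λ a b, computed by recursion on the splitting
-- tree, and δ(a,b) is its minimum; so (IV) and (V) say the same thing.
-- Without bad walks Prover ensures (III): at v she offers start, start + 2, …, where start is the
-- largest lower bound f(x) − λ(Q) over earlier x and looping walks Q from x to v.  The matching upper
-- bounds come from joining two such walks at v, and from λ(Q) ≥ β(v) − 1 when they start at the same x.
-- Conversely, against a model of Ψ Adversary answers at v with a value incompatible with some earlier
-- vertex along a looping walk whenever one is offered.  By induction on looping walks the ends of
-- every looping walk then get λ-compatible values (at a splitting vertex m with β(m) = 2 both offered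
-- values are compatible with both ends, which gains the −2 in λ), and a bad walk contradicts this at
-- its last vertex.  (III) ⇒ (II) since an edge is a looping walk with λ = 1 and, G being bipartite,
-- δ is odd on edges.

gap : ∀ {a b} → a ≤ b → 0ℤ ≤ b - a
gap = ℤP.i≤j⇒0≤j-i

infixl 6 _⊕_
_⊕_ : ∀ {x y} → 0ℤ ≤ x → 0ℤ ≤ y → 0ℤ ≤ x + y
_⊕_ = ℤP.+-mono-≤

≤-by-slack : ∀ {x y s} → 0ℤ ≤ s → s ≡ y - x → x ≤ y
≤-by-slack 0≤s refl = ℤP.0≤i-j⇒j≤i 0≤s

Even : ℤ → Set
Even z = + 2 Signed.∣ z

even-0 : Even 0ℤ
even-0 = divides 0ℤ refl

even-double : ∀ x → Even (x + x)
even-double x = divides x (((∀ x → x + x ≡ x * + 2) ∋ solve-∀) x)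

even-2* : ∀ k → Even (+ (2 ℕ.* k))
even-2* k = divides (+ k) (trans (ℤP.pos-* 2 k) (ℤP.*-comm (+ 2) (+ k)))

¬even-1 : ¬ Even (+ 1)
¬even-1 (divides (+ zero) ())
¬even-1 (divides (+ suc q) ())
¬even-1 (divides -[1+ q ] ())

even-gap : ∀ {p q} → Even (p - q) → p ≢ q → (p + + 2 ≤ q) ⊎ (q + + 2 ≤ p)
even-gap {p} {q} (divides (+ zero) eq) p≢q = ⊥-elim (p≢q (ℤP.i-j≡0⇒i≡j p q eq))
even-gap {p} {q} (divides (+ suc k) eq) _ = inj₂ (≤-by-slack (+≤+ ℕ.z≤n) (sym (begin
  p - (q + + 2)             ≡⟨ ((∀ p q → p - (q + + 2) ≡ (p - q) - + 2) ∋ solve-∀) p q ⟩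
  (p - q) - + 2             ≡⟨ cong (_- + 2) eq ⟩
  (+ 1 + + k) * + 2 - + 2   ≡⟨ ((∀ k → (+ 1 + k) * + 2 - + 2 ≡ k + k) ∋ solve-∀) (+ k) ⟩
  + k + + k                 ∎)))
  where open ≡-Reasoning
even-gap {p} {q} (divides -[1+ k ] eq) _ = inj₁ (≤-by-slack (+≤+ ℕ.z≤n) (sym (begin
  q - (p + + 2)                 ≡⟨ ((∀ p q → q - (p + + 2) ≡ - (p - q) - + 2) ∋ solve-∀) p q ⟩
  - (p - q) - + 2               ≡⟨ cong (λ z → - z - + 2) eq ⟩
  - (- (+ 1 + + k) * + 2) - + 2 ≡⟨ ((∀ k → - (- (+ 1 + k) * + 2) - + 2 ≡ k + k) ∋ solve-∀) (+ k) ⟩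
  + k + + k                     ∎)))
  where open ≡-Reasoning

even-join : ∀ {x m y l₁ l₂ w} → Even (x + m + l₁) → Even (m + y + l₂) → Even w →
            Even (x + y + (l₁ + l₂ - w))
even-join {x} {m} {y} {l₁} {l₂} {w} e₁ e₂ ew =
  subst Even (((∀ x m y l₁ l₂ w → x + m + l₁ + (m + y + l₂) - (m + m) - w ≡ x + y + (l₁ + l₂ - w))
               ∋ solve-∀) x m y l₁ l₂ w)
    (∣m∣n⇒∣m-n (∣m∣n⇒∣m-n (∣m∣n⇒∣m+n e₁ e₂) (even-double m)) ew)

record Bounded (d x y : ℤ) : Set where
  constructor bounded
  field
    ≤ˡ : x - y ≤ d
    ≤ʳ : y - x ≤ d

record Compatible (d x y : ℤ) : Set where
  constructor compatible
  field
    bounds : Bounded d x y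
    even   : Even (x + y + d)

bounded-trans : ∀ {l₁ l₂ x m y} → Bounded l₁ x m → Bounded l₂ m y → Bounded (l₁ + l₂) x y
bounded-trans {l₁} {l₂} {x} {m} {y} (bounded xm mx) (bounded my ym) =
  bounded (≤-by-slack (gap xm ⊕ gap my) (chain x m y)) (≤-by-slack (gap mx ⊕ gap ym) (chain′ y m x))
  where
  chain : ∀ a b c → l₁ - (a - b) + (l₂ - (b - c)) ≡ l₁ + l₂ - (a - c)
  chain = ((∀ l₁ l₂ a b c → l₁ - (a - b) + (l₂ - (b - c)) ≡ l₁ + l₂ - (a - c)) ∋ solve-∀) l₁ l₂
  chain′ : ∀ a b c → l₁ - (b - c) + (l₂ - (a - b)) ≡ l₁ + l₂ - (a - c)
  chain′ = ((∀ l₁ l₂ a b c → l₁ - (b - c) + (l₂ - (a - b)) ≡ l₁ + l₂ - (a - c)) ∋ solve-∀) l₁ l₂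

squeeze : ∀ {a b r s k₁ k₂} → a - r ≤ k₁ → s - b ≤ k₂ → r + + 2 ≤ s → a - b ≤ k₁ + k₂ - + 2
squeeze {a} {b} {r} {s} {k₁} {k₂} ar sb r+2≤s = ≤-by-slack (gap ar ⊕ gap sb ⊕ gap r+2≤s)
  (((∀ a b r s k₁ k₂ → k₁ - (a - r) + (k₂ - (s - b)) + (s - (r + + 2)) ≡ k₁ + k₂ - + 2 - (a - b))
     ∋ solve-∀) a b r s k₁ k₂)

squeeze′ : ∀ {a b r s k₁ k₂} → a - r ≤ k₂ → s - b ≤ k₁ → r + + 2 ≤ s → a - b ≤ k₁ + k₂ - + 2
squeeze′ {a} {b} {r} {k₁ = k₁} {k₂} ar sb r+2≤s =
  subst (λ k → a - b ≤ k - + 2) (ℤP.+-comm k₂ k₁) (squeeze {a} {b} {r} ar sb r+2≤s)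

bounded-via-distinct-midpoints :
  ∀ {e₁ e₂ x p q y} → Compatible e₁ x p → Compatible e₁ x q → Bounded e₂ p y → Bounded e₂ q y → p ≢ q →
  Bounded (e₁ + e₂ - + 2) x y
bounded-via-distinct-midpoints {e₁} {e₂} {x} {p} {q} {y}
  (compatible (bounded xp px) ep) (compatible (bounded xq qx) eq) (bounded py yp) (bounded qy yq) p≢q
  with even-gap (subst Even (((∀ x p q e → x + p + e - (x + q + e) ≡ p - q) ∋ solve-∀) x p q e₁)
                           (∣m∣n⇒∣m-n ep eq)) p≢q
... | inj₁ p+2≤q = bounded (squeeze {x} {y} {p} xp qy p+2≤q) (squeeze′ {y} {x} {p} yp qx p+2≤q)
... | inj₂ q+2≤p = bounded (squeeze {x} {y} {q} xq py q+2≤p) (squeeze′ {y} {x} {q} yq px q+2≤p)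

bounded-nonneg : ∀ {d x y} → Bounded d x y → 0ℤ ≤ d
bounded-nonneg {x = x} {y} (bounded xy yx) with ℤP.≤-total x y
... | inj₁ x≤y = ℤP.≤-trans (gap x≤y) yx
... | inj₂ y≤x = ℤP.≤-trans (gap y≤x) xy

bounded-nonpos⇒≡ : ∀ {d x y} → Bounded d x y → d ≤ 0ℤ → x ≡ y
bounded-nonpos⇒≡ (bounded xy yx) d≤0 =
  ℤP.≤-antisym (ℤP.i-j≤0⇒i≤j (ℤP.≤-trans xy d≤0)) (ℤP.i-j≤0⇒i≤j (ℤP.≤-trans yx d≤0))

bounded⇒∣-∣≤ : ∀ {d x y} → Bounded d x y → + ∣ x - y ∣ ≤ d
bounded⇒∣-∣≤ {d} {x} {y} (bounded xy yx) =
  abs (x - y) xy (subst (_≤ d) (((∀ x y → y - x ≡ - (x - y)) ∋ solve-∀) x y) yx)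
  where
  abs : ∀ z → z ≤ d → - z ≤ d → + ∣ z ∣ ≤ d
  abs (+ _)    z≤d _ = z≤d
  abs -[1+ _ ] _ -z≤d = -z≤d

∣-∣≡1⇒compatible : ∀ {x y} → ∣ x - y ∣ ≡ 1 → Compatible (+ 1) x y
∣-∣≡1⇒compatible {x} {y} ∣x-y∣≡1 = unit (x - y) refl ∣x-y∣≡1
  where
  flip : y - x ≡ - (x - y)
  flip = ((∀ x y → y - x ≡ - (x - y)) ∋ solve-∀) x y
  regroup : x + y + + 1 ≡ (x - y + + 1) + (y + y)
  regroup = ((∀ x y → x + y + + 1 ≡ (x - y + + 1) + (y + y)) ∋ solve-∀) x y
  unit : ∀ z → x - y ≡ z → ∣ z ∣ ≡ 1 → Compatible (+ 1) x y
  unit (+ 1) eq _ =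
    compatible (bounded (ℤP.≤-reflexive eq) (subst (_≤ + 1) (sym (trans flip (cong -_ eq))) -≤+))
    (subst Even (sym regroup) (∣m∣n⇒∣m+n (subst (λ z → Even (z + + 1)) (sym eq) (even-2* 1)) (even-double y)))
  unit -[1+ 0 ] eq _ =
    compatible (bounded (subst (_≤ + 1) (sym eq) -≤+) (ℤP.≤-reflexive (trans flip (cong -_ eq))))
    (subst Even (sym regroup) (∣m∣n⇒∣m+n (subst (λ z → Even (z + + 1)) (sym eq) even-0) (even-double y)))

∣∣≤1∧odd⇒∣∣≡1 : ∀ {z} → + ∣ z ∣ ≤ + 1 → ¬ Even z → ∣ z ∣ ≡ 1
∣∣≤1∧odd⇒∣∣≡1 {+ 0}             _ odd = ⊥-elim (odd even-0)
∣∣≤1∧odd⇒∣∣≡1 {+ 1}             _ _   = refl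
∣∣≤1∧odd⇒∣∣≡1 {+ suc (suc _)}   (+≤+ (ℕ.s≤s ())) _
∣∣≤1∧odd⇒∣∣≡1 { -[1+ 0 ]}       _ _   = refl
∣∣≤1∧odd⇒∣∣≡1 { -[1+ suc _ ]}   (+≤+ (ℕ.s≤s ())) _

compatible-sym : ∀ {d x y} → Compatible d x y → Compatible d y x
compatible-sym {d} {x} {y} (compatible (bounded xy yx) even) =
  compatible (bounded yx xy) (subst (λ s → Even (s + d)) (ℤP.+-comm x y) even)

compatible? : ∀ d x y → Dec (Compatible d x y)
compatible? d x y = map′ (λ ((xy , yx) , even) → compatible (bounded xy yx) even)
                          (λ (compatible (bounded xy yx) even) → (xy , yx) , even)
                          (((x - y ℤP.≤? d) ×-dec (y - x ℤP.≤? d)) ×-dec (+ 2 Signed.∣? (x + y + d)))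

maxOr : ℤ → List ℤ → ℤ
maxOr d []       = d
maxOr _ (x ∷ xs) = Extrema.max x xs

≤-maxOr : ∀ {d x xs} → x ∈ xs → x ≤ maxOr d xs
≤-maxOr {xs = y ∷ ys} (here refl)  = Extrema.v≤max⁺ y ys (inj₁ ℤP.≤-refl)
≤-maxOr {xs = y ∷ ys} (there x∈ys) = Extrema.v≤max⁺ y ys (inj₂ (lose x∈ys ℤP.≤-refl))

maxOr-∈ : ∀ {d x xs} → x ∈ xs → maxOr d xs ∈ xs
maxOr-∈ {xs = y ∷ ys} _ with Extrema.argmax-sel (λ z → z) y ys
... | inj₁ max≡y = here max≡y
... | inj₂ max∈ys = there max∈ys

maxOr-all : ∀ {P : ℤ → Set} {d xs} → P d → All P xs → P (maxOr d xs)
maxOr-all pd []         = pd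
maxOr-all _  (px ∷ pxs) = Extrema.argmax-all (λ z → z) px pxs

ladder : ℤ → ℕ → List ℤ
ladder w k = applyUpTo (λ i → w + + (2 ℕ.* i)) k

ladder-unique : ∀ w k → Unique (ladder w k)
ladder-unique w k = applyUpTo⁺₁ _ k (λ i<j _ → ℤP.<⇒≢ (ℤP.+-monoʳ-< w (+<+ (ℕP.*-monoʳ-< 2 i<j))))

∈-ladder : ∀ {w k z} → z ∈ ladder w (suc k) → (w ≤ z) × (z ≤ w + + (2 ℕ.* k)) × Even (z - w)
∈-ladder {w} {k} z∈ with ∈-applyUpTo⁻ (λ i → w + + (2 ℕ.* i)) z∈
... | i , i<1+k , refl =
  ℤP.i≤i+j w (+ (2 ℕ.* i)) ,
  ℤP.+-monoʳ-≤ w (ℤ.+≤+ (ℕP.*-monoʳ-≤ 2 (ℕP.≤-pred i<1+k))) ,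
  subst Even (((∀ w x → x ≡ w + x - w) ∋ solve-∀) w (+ (2 ℕ.* i))) (even-2* i)

prefer : ∀ {A : Set} {P : A → Set} → Decidable P → ∀ z₀ zs →
         Σ[ z ∈ A ] (z ∈ z₀ ∷ zs) × (Any P (z₀ ∷ zs) → P z)
prefer P? z₀ zs with Any.any? P? (z₀ ∷ zs)
... | yes some with find some
...   | z , z∈ , pz = z , z∈ , λ _ → pz
prefer P? z₀ zs | no none = z₀ , here refl , λ some → ⊥-elim (none some)

two-distinct : ∀ {A : Set} (zs : List A) → length zs ≡ 2 → Unique zs →
               Σ[ z₁ ∈ A ] Σ[ z₂ ∈ A ] (z₁ ∈ zs) × (z₂ ∈ zs) × (z₁ ≢ z₂)
two-distinct (z₁ ∷ z₂ ∷ []) refl ((z₁≢z₂ ∷ []) ∷ _) = z₁ , z₂ , here refl , there (here refl) , z₁≢z₂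

module Plays (n : ℕ) (atoms : List (Fin n × Fin n)) (β : Fin n → ℕ) where
  open Instance n atoms β

  update-≡ : ∀ (f : V → ℤ) v z → (f [ v ↦ z ]) v ≡ z
  update-≡ f v z with v ≟ v
  ... | yes _ = refl
  ... | no v≢v = ⊥-elim (v≢v refl)

  update-≢ : ∀ (f : V → ℤ) {v w} z → w ≢ v → (f [ v ↦ z ]) w ≡ f w
  update-≢ f {v} {w} z w≢v with w ≟ v
  ... | yes w≡v = ⊥-elim (w≢v w≡v)
  ... | no _ = refl

  data Suffix : ℕ → List V → Set where
    []  : Suffix n []
    _∷_ : ∀ {t v vs} → toℕ v ≡ t → Suffix (suc t) vs → Suffix t (v ∷ vs)

  tabulate-suffix : ∀ k t (f : Fin k → V) → (∀ i → toℕ (f i) ≡ t ℕ.+ toℕ i) → t ℕ.+ k ≡ n →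
                    Suffix t (tabulate f)
  tabulate-suffix zero t f _ t+0≡n = subst (λ s → Suffix s []) (trans (sym t+0≡n) (ℕP.+-identityʳ t)) []
  tabulate-suffix (suc k) t f f≗ t+k≡n =
    trans (f≗ F.zero) (ℕP.+-identityʳ t) ∷
    tabulate-suffix k (suc t) (f ∘ F.suc) (λ i → trans (f≗ (F.suc i)) (ℕP.+-suc t (toℕ i)))
                    (trans (sym (ℕP.+-suc t k)) t+k≡n)

  vars-suffix : Suffix 0 vars
  vars-suffix = tabulate-suffix n 0 (λ i → i) (λ _ → refl) refl

  below-next : ∀ {x v : V} {t} → toℕ v ≡ t → toℕ x ℕ.< suc t → x ≢ v → toℕ x ℕ.< t
  below-next refl x<1+v x≢v with ℕP.m≤n⇒m<n∨m≡n (ℕP.≤-pred x<1+v)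
  ... | inj₁ x<v = x<v
  ... | inj₂ x≡v = ⊥-elim (x≢v (FP.toℕ-injective x≡v))

  wins⇒sat : ∀ σ → Legal σ → ∀ vs f → (∀ g → Play σ vs f g → Hom g) → Sat vs f
  wins⇒sat σ legal [] f wins = wins f done
  wins⇒sat σ legal (v ∷ vs) f wins =
    σ v f , proj₁ (legal v f) , proj₂ (legal v f) ,
    All.tabulate (λ z∈ → wins⇒sat σ legal vs (f [ v ↦ _ ]) (λ g play → wins g (step z∈ play)))

  proverWins⇒models : ProverWins → Models
  proverWins⇒models (σ , legal , wins) = wins⇒sat σ legal vars f₀ wins

module LoopingWalks (n : ℕ) (atoms : List (Fin n × Fin n)) (β : Fin n → ℕ) where
  open Instance n atoms β

  weight : V → ℤ
  weight m = + (2 ℕ.* (β m ∸ 1))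

  -- The goal is the identity below at + length ys, …, definitionally: + m + + n computes to
  -- + (m ℕ.+ n), and 2 ℕ.* k unfolds to k ℕ.+ (k ℕ.+ 0).
  λw-++ : ∀ ys m zs → λw (ys ++ m ∷ zs) ≡ λw ys + λw zs - weight m
  λw-++ ys m zs
    rewrite LP.length-++ ys {m ∷ zs}
          | LP.map-++ (λ x → β x ∸ 1) ys (m ∷ zs)
          | sum-++ (map (λ x → β x ∸ 1) ys) (map (λ x → β x ∸ 1) (m ∷ zs))
    = identity (+ length ys) (+ length zs) (+ sum (map (λ x → β x ∸ 1) ys))
               (+ sum (map (λ x → β x ∸ 1) zs)) (+ (β m ∸ 1))
    where
    identity : ∀ ly lz sy sz w →
      + 1 + (ly + (+ 1 + lz)) - ((sy + (w + sz)) + ((sy + (w + sz)) + + 0))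
        ≡ (+ 1 + ly - (sy + (sy + + 0))) + (+ 1 + lz - (sz + (sz + + 0))) - (w + (w + + 0))
    identity = solve-∀

  adj-sym : ∀ {a b} → Adj a b → Adj b a
  adj-sym (inj₁ ab) = inj₂ ab
  adj-sym (inj₂ ba) = inj₁ ba

  open DecMembership (×P.≡-dec (_≟_ {n}) (_≟_ {n})) using (_∈?_)

  adj? : ∀ a b → Dec (Adj a b)
  adj? a b = ((a , b) ∈? atoms) ⊎-dec ((b , a) ∈? atoms)

  Above : V → V → V → Set
  Above a b m = (a F.< m) × (b F.< m)

  above : V → V → List V
  above a b = filter (λ m → (a F.<? m) ×-dec (b F.<? m)) (allFin n)

  ∈-above⁺ : ∀ {a b m} → Above a b m → m ∈ above a b
  ∈-above⁺ {m = m} = ∈-filter⁺ (λ m → _ F.<? m ×-dec _ F.<? m) (∈-allFin m)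

  ∈-above⁻ : ∀ {a b m} → m ∈ above a b → Above a b m
  ∈-above⁻ = proj₂ ∘ ∈-filter⁻ (λ m → _ F.<? m ×-dec _ F.<? m) {xs = allFin n}

  splitting-vertex-above : ∀ {a b m} ys {zs} → Interior< a b (ys ++ m ∷ zs) → Above a b m
  splitting-vertex-above ys int with AllP.++⁻ ys int
  ... | _ , (a<m×b<m ∷ _) = a<m×b<m

  join : ∀ {a b m ys zs} → a ≢ b → Above a b m → Looping a ys m → Looping m zs b →
         Looping a (ys ++ m ∷ zs) b
  join {a} {b} {m} {ys} {zs} a≢b (a<m , b<m) L₁ L₂ =
    comb a≢b (AllP.++⁺ (All.map left (interior L₁)) ((a<m , b<m) ∷ All.map right (interior L₂))) L₁ L₂
    where
    interior : ∀ {x is y} → Looping x is y → Interior< x y is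
    interior (edge _ _) = []
    interior (comb _ int _ _) = int
    left : ∀ {x} → (a F.< x) × (m F.< x) → (a F.< x) × (b F.< x)
    left (a<x , m<x) = a<x , ℕP.<-trans b<m m<x
    right : ∀ {x} → (m F.< x) × (b F.< x) → (a F.< x) × (b F.< x)
    right (m<x , b<x) = ℕP.<-trans a<m m<x , b<x

  joinλ : V → ℤ → ℤ → ℤ
  joinλ m x y = x + y - weight m

  edgeLambda : V → V → List ℤ
  edgeLambda a b with adj? a b
  ... | yes _ = [ + 1 ]
  ... | no _  = []

  -- lambdas k a b lists λ(Q) for the looping walks Q from a to b whose splitting tree has height at most k.
  mutual
    lambdas : ℕ → V → V → List ℤ
    lambdas k a b with a ≟ b
    ... | yes _ = []
    ... | no _  = edgeLambda a b ++ splitLambdas k a b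

    splitLambdas : ℕ → V → V → List ℤ
    splitLambdas zero    a b = []
    splitLambdas (suc k) a b =
      concatMap (λ m → cartesianProductWith (joinλ m) (lambdas k a m) (lambdas k m b)) (above a b)

  ∈-edge : ∀ {k a b} → a ≢ b → Adj a b → + 1 ∈ lambdas k a b
  ∈-edge {k} {a} {b} a≢b ab with a ≟ b
  ... | yes a≡b = ⊥-elim (a≢b a≡b)
  ... | no _ with adj? a b
  ...   | yes _  = here refl
  ...   | no ¬ab = ⊥-elim (¬ab ab)

  ∈-split : ∀ {k a b m x y} → a ≢ b → Above a b m → x ∈ lambdas k a m → y ∈ lambdas k m b →
            joinλ m x y ∈ lambdas (suc k) a b
  ∈-split {k} {a} {b} {m} a≢b a,b<m x∈ y∈ with a ≟ b
  ... | yes a≡b = ⊥-elim (a≢b a≡b)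
  ... | no _ = ∈-++⁺ʳ (edgeLambda a b) (∈-concatMap⁺ _ {xs = above a b}
                 (lose (∈-above⁺ a,b<m) (∈-cartesianProductWith⁺ (joinλ m) x∈ y∈)))

  lambdas-sound : ∀ k a b {d} → d ∈ lambdas k a b → Σ[ is ∈ List V ] Looping a is b × λw is ≡ d
  lambdas-sound k a b d∈ with a ≟ b
  lambdas-sound k a b () | yes _
  ... | no a≢b with ∈-++⁻ (edgeLambda a b) d∈
  ...   | inj₁ d∈e = edge-sound d∈e
    where
    edge-sound : ∀ {d} → d ∈ edgeLambda a b → Σ[ is ∈ List V ] Looping a is b × λw is ≡ d
    edge-sound d∈e with adj? a b
    edge-sound (here refl) | yes ab = [] , edge a≢b ab , refl
  ...   | inj₂ d∈s = split-sound k d∈s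
    where
    split-sound : ∀ k {d} → d ∈ splitLambdas k a b → Σ[ is ∈ List V ] Looping a is b × λw is ≡ d
    split-sound (suc k) d∈s with find (∈-concatMap⁻ _ {xs = above a b} d∈s)
    ... | m , m∈ , d∈m with ∈-cartesianProductWith⁻ (joinλ m) (lambdas k a m) (lambdas k m b) d∈m
    ... | x , y , x∈ , y∈ , refl with lambdas-sound k a m x∈ | lambdas-sound k m b y∈
    ... | ys , L₁ , refl | zs , L₂ , refl = ys ++ m ∷ zs , join a≢b (∈-above⁻ m∈) L₁ L₂ , λw-++ ys m zs

  -- The interior of a looping walk lies above both ends, so this much fuel bounds its splitting tree.
  Fuel : ℕ → V → V → Set
  Fuel k a b = (n ℕ.≤ suc (toℕ a) ℕ.+ k) ⊎ (n ℕ.≤ suc (toℕ b) ℕ.+ k)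

  fuel-descend : ∀ {a m k} → n ℕ.≤ suc a ℕ.+ k → a ℕ.< m → m ℕ.< n →
                 Σ[ k′ ∈ ℕ ] (k ≡ suc k′) × (n ℕ.≤ suc m ℕ.+ k′)
  fuel-descend {a} {m} {zero} n≤ a<m m<n =
    ⊥-elim (ℕP.<-irrefl refl (ℕP.<-≤-trans m<n (ℕP.≤-trans (subst (n ℕ.≤_) (ℕP.+-identityʳ (suc a)) n≤) a<m)))
  fuel-descend {a} {m} {suc k} n≤ a<m m<n = k , refl , (begin
    n                 ≤⟨ n≤ ⟩
    suc a ℕ.+ suc k   ≡⟨ ℕP.+-suc (suc a) k ⟩
    suc (suc a) ℕ.+ k ≤⟨ ℕP.+-monoˡ-≤ k (ℕ.s≤s a<m) ⟩
    suc m ℕ.+ k       ∎)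
    where open ℕP.≤-Reasoning

  fuel-split : ∀ {k a b m} → Fuel k a b → Above a b m →
               Σ[ k′ ∈ ℕ ] (k ≡ suc k′) × (n ℕ.≤ suc (toℕ m) ℕ.+ k′)
  fuel-split {m = m} (inj₁ fuel) (a<m , _) = fuel-descend fuel a<m (FP.toℕ<n m)
  fuel-split {m = m} (inj₂ fuel) (_ , b<m) = fuel-descend fuel b<m (FP.toℕ<n m)

  lambdas-complete : ∀ {k a is b} → Looping a is b → Fuel k a b →
                     (λw is ∈ lambdas k a b) × (λw is ∈ lambdas k b a)
  lambdas-complete (edge a≢b ab) _ = ∈-edge a≢b ab , ∈-edge (a≢b ∘ sym) (adj-sym ab)
  lambdas-complete (comb {m = m} {ys} {zs} a≢b int L₁ L₂) fuel
    with splitting-vertex-above ys int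
  ... | a<m , b<m with fuel-split fuel (a<m , b<m)
  ... | k′ , refl , fuel′ with lambdas-complete L₁ (inj₂ fuel′) | lambdas-complete L₂ (inj₁ fuel′)
  ... | x∈ , x∈′ | y∈ , y∈′ =
    subst (_∈ _) (sym (λw-++ ys m zs)) (∈-split a≢b (a<m , b<m) x∈ y∈) ,
    subst (_∈ _) (trans (cong (_- weight m) (ℤP.+-comm (λw zs) (λw ys))) (sym (λw-++ ys m zs)))
      (∈-split (a≢b ∘ sym) (b<m , a<m) y∈′ x∈′)

  Λ : V → V → List ℤ
  Λ = lambdas n

  Λ-complete : ∀ {a is b} → Looping a is b → (λw is ∈ Λ a b) × (λw is ∈ Λ b a)
  Λ-complete {a} L = lambdas-complete L (inj₁ (ℕP.m≤n+m n (suc (toℕ a))))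

  Λ-sound : ∀ a b {d} → d ∈ Λ a b → Σ[ is ∈ List V ] Looping a is b × λw is ≡ d
  Λ-sound = lambdas-sound n

  Λ-sym : ∀ a b {d} → d ∈ Λ a b → d ∈ Λ b a
  Λ-sym a b d∈ with Λ-sound a b d∈
  ... | _ , L , refl = proj₂ (Λ-complete L)

  Λ-join : ∀ {a b m d₁ d₂} → a ≢ b → Above a b m → d₁ ∈ Λ a m → d₂ ∈ Λ m b → joinλ m d₁ d₂ ∈ Λ a b
  Λ-join {a} {b} {m} a≢b a,b<m d₁∈ d₂∈ with Λ-sound a m d₁∈ | Λ-sound m b d₂∈
  ... | ys , L₁ , refl | zs , L₂ , refl =
    subst (_∈ Λ a b) (λw-++ ys m zs) (proj₁ (Λ-complete (join a≢b a,b<m L₁ L₂)))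

  Λ-irreflexive : ∀ a {d} → ¬ (d ∈ Λ a a)
  Λ-irreflexive a d∈ with Λ-sound a a d∈
  ... | _ , edge a≢a _ , _       = a≢a refl
  ... | _ , comb a≢a _ _ _ , _   = a≢a refl

  loopVal⇒∈Λ : ∀ {a b d} → LoopVal a b d → d ∈ Λ a b
  loopVal⇒∈Λ (_ , inj₁ L , refl) = proj₁ (Λ-complete L)
  loopVal⇒∈Λ (_ , inj₂ L , refl) = proj₂ (Λ-complete L)

  ∈Λ⇒loopVal : ∀ {a b d} → d ∈ Λ a b → LoopVal a b d
  ∈Λ⇒loopVal {a} {b} d∈ with Λ-sound a b d∈
  ... | is , L , λ≡d = is , inj₁ L , λ≡d

  isDelta⇒∈Λ : ∀ {a b d} → IsDelta a b d → d ∈ Λ a b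
  isDelta⇒∈Λ (loopVal , _) = loopVal⇒∈Λ loopVal

  ∈Λ⇒isDelta-≤ : ∀ {a b d} → d ∈ Λ a b → Σ[ e ∈ ℤ ] IsDelta a b e × e ≤ d
  ∈Λ⇒isDelta-≤ {a} {b} {d} d∈ = e , (∈Λ⇒loopVal e∈ , minimal) , Extrema.min≤⊤ d (Λ a b)
    where
    e : ℤ
    e = Extrema.min d (Λ a b)
    e∈ : e ∈ Λ a b
    e∈ with Extrema.argmin-sel (λ z → z) d (Λ a b)
    ... | inj₁ e≡d = subst (_∈ Λ a b) (sym e≡d) d∈
    ... | inj₂ e∈′ = e∈′
    minimal : ∀ d′ → LoopVal a b d′ → e ≤ d′
    minimal d′ loopVal = All.lookup (Extrema.min≤xs d (Λ a b)) (loopVal⇒∈Λ loopVal)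

  looping-parity : (p : V → ℤ) → (∀ {a b} → Adj a b → Even (p a + p b + + 1)) →
                   ∀ {a is b} → Looping a is b → Even (p a + p b + λw is)
  looping-parity p p-edge (edge _ ab) = p-edge ab
  looping-parity p p-edge {a} {_} {b} (comb {m = m} {ys} {zs} _ _ L₁ L₂) =
    subst (λ l → Even (p a + p b + l)) (sym (λw-++ ys m zs))
      (even-join {p a} {p m} {p b} (looping-parity p p-edge L₁) (looping-parity p p-edge L₂) (even-2* (β m ∸ 1)))

  noSmallDelta⇔noBadWalk : NoSmallDelta ⇔ (¬ BadWalk)
  noSmallDelta⇔noBadWalk = mk⇔ to from
    where
    to : NoSmallDelta → ¬ BadWalk
    to noSmall (a , is , b , L , a<b , λ≤) with ∈Λ⇒isDelta-≤ (proj₁ (Λ-complete L))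
    ... | e , isδ , e≤λ = noSmall (a , b , e , a<b , isδ , ℤP.≤-trans e≤λ λ≤)
    from : ¬ BadWalk → NoSmallDelta
    from noBad (u , v , d , u<v , isδ , d≤) with Λ-sound u v (isDelta⇒∈Λ isδ)
    ... | is , L , refl = noBad (u , is , v , L , u<v , d≤)

module ProverStrategy (n : ℕ) (atoms : List (Fin n × Fin n)) (β : Fin n → ℕ)
                      (β-pos : ∀ v → 1 ℕ.≤ β v) (bipartite : Bipartite n atoms) where
  open Instance n atoms β
  open LoopingWalks n atoms β
  open Plays n atoms β

  colour : V → ℤ
  colour v = if proj₁ bipartite v then + 1 else + 0

  colour-edge : ∀ {a b} → Adj a b → Even (colour a + colour b + + 1)
  colour-edge {a} {b} ab with proj₁ bipartite a | proj₁ bipartite b | colours-differ ab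
    where
    colours-differ : Adj a b → proj₁ bipartite a ≢ proj₁ bipartite b
    colours-differ (inj₁ ab) = proj₂ bipartite ab
    colours-differ (inj₂ ba) = proj₂ bipartite ba ∘ sym
  ... | true  | true  | ≢ = ⊥-elim (≢ refl)
  ... | true  | false | _ = divides (+ 1) refl
  ... | false | true  | _ = divides (+ 1) refl
  ... | false | false | ≢ = ⊥-elim (≢ refl)

  Λ-parity : ∀ a b {d} → d ∈ Λ a b → Even (colour a + colour b + d)
  Λ-parity a b d∈ with Λ-sound a b d∈
  ... | _ , L , refl = looping-parity colour colour-edge L

  deltaCond⇒hom : ∀ g → DeltaCond g → Hom g
  deltaCond⇒hom g deltaCond {u} {v} uv with ∈Λ⇒isDelta-≤ (proj₁ (Λ-complete (edge u≢v (inj₁ uv))))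
    where
    u≢v : u ≢ v
    u≢v refl = proj₂ bipartite uv refl
  ... | d , isδ , d≤1 with deltaCond u v d isδ
  ... | ∣∣≤d , 2∣ = ∣∣≤1∧odd⇒∣∣≡1 (ℤP.≤-trans ∣∣≤d d≤1) odd
    where
    odd : ¬ Even (g u - g v)
    odd even = ¬even-1 (subst Even
      (((∀ gu gv cu cv d → cu + cv + + 1 - (cu + cv + d) + (gu + gv + d) - (gu - gv) - (gv + gv) ≡ + 1) ∋ solve-∀)
         (g u) (g v) (colour u) (colour v) d)
      (∣m∣n⇒∣m-n (∣m∣n⇒∣m-n (∣m∣n⇒∣m+n (∣m∣n⇒∣m-n (colour-edge (inj₁ uv)) (Λ-parity u v (isDelta⇒∈Λ isδ)))
                                        (∣ᵤ⇒∣ 2∣))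
                             even)
                  (even-double (g v))))

  proverEnsures⇒proverWins : ProverCanEnsure DeltaCond → ProverWins
  proverEnsures⇒proverWins (σ , legal , ensures) = σ , legal , λ g play → deltaCond⇒hom g (ensures g play)

  module _ (noBad : ¬ BadWalk) where

    β∸1≤Λ : ∀ {x v e} → x F.< v → e ∈ Λ x v → + (β v ∸ 1) ≤ e
    β∸1≤Λ {x} {v} x<v e∈ with Λ-sound x v e∈
    ... | is , L , refl with λw is ℤP.≤? + β v - + 2
    ...   | yes small = ⊥-elim (noBad (x , is , v , L , x<v , small))
    ...   | no ¬small = subst (_≤ λw is) (pred≡ (β v) (β-pos v)) (ℤP.i<j⇒suc[i]≤j (ℤP.≰⇒> ¬small))
      where
      pred≡ : ∀ b → 1 ℕ.≤ b → ℤ.suc (+ b - + 2) ≡ + (b ∸ 1)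
      pred≡ (suc k) _ = ((∀ k → + 1 + (+ 1 + k - + 2) ≡ k) ∋ solve-∀) (+ k)

    weight≤Λ+Λ : ∀ {x y v e e′} → x F.< v → y F.< v → e ∈ Λ x v → e′ ∈ Λ y v → weight v ≤ e + e′
    weight≤Λ+Λ {v = v} {e} {e′} x<v y<v e∈ e′∈ =
      subst (_≤ e + e′) (cong (λ k → + (β v ∸ 1 ℕ.+ k)) (sym (ℕP.+-identityʳ (β v ∸ 1))))
        (ℤP.+-mono-≤ (β∸1≤Λ x<v e∈) (β∸1≤Λ y<v e′∈))

    below : V → List V
    below v = filter (F._<? v) (allFin n)

    lowerBounds : V → (V → ℤ) → List ℤ
    lowerBounds v h = concatMap (λ x → map (λ e → h x - e) (Λ x v)) (below v)

    ∈-lowerBounds⁺ : ∀ {v h x e} → x F.< v → e ∈ Λ x v → h x - e ∈ lowerBounds v h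
    ∈-lowerBounds⁺ {v} {h} {x} x<v e∈ =
      ∈-concatMap⁺ _ {xs = below v} (lose (∈-filter⁺ (F._<? v) (∈-allFin x) x<v) (∈-map⁺ (λ e → h x - e) e∈))

    ∈-lowerBounds⁻ : ∀ {v h l} → l ∈ lowerBounds v h →
                     Σ[ y ∈ V ] Σ[ e ∈ ℤ ] (y F.< v) × (e ∈ Λ y v) × (l ≡ h y - e)
    ∈-lowerBounds⁻ {v} {h} l∈ with find (∈-concatMap⁻ _ {xs = below v} l∈)
    ... | y , y∈ , l∈y with ∈-map⁻ (λ e → h y - e) l∈y
    ... | e , e∈ , refl = y , e , proj₂ (∈-filter⁻ (F._<? v) {xs = allFin n} y∈) , e∈ , refl

    -- start is the tightest lower bound h x - λ(Q) over earlier x and looping walks Q from x to v;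
    -- when there is none, the colour of v fixes the parity.
    start : V → (V → ℤ) → ℤ
    start v h = maxOr (colour v) (lowerBounds v h)

    strategy : Strategy
    strategy v h = ladder (start v h) (β v)

    strategy-legal : Legal strategy
    strategy-legal v h = LP.length-applyUpTo _ (β v) , ladder-unique (start v h) (β v)

    offered : ∀ {v h z} → z ∈ strategy v h →
              (start v h ≤ z) × (z ≤ start v h + weight v) × Even (z - start v h)
    offered {v} {h} z∈ = ∈-ladder (subst (λ k → _ ∈ ladder (start v h) k) (sym (ℕP.m+[n∸m]≡n (β-pos v))) z∈)

    record Consistent (t : ℕ) (h : V → ℤ) : Set where
      field
        parity : ∀ x → toℕ x ℕ.< t → Even (h x - colour x)
        close  : ∀ x y {e} → toℕ x ℕ.< t → toℕ y ℕ.< t → e ∈ Λ x y → h x - h y ≤ e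

    consistent-extend : ∀ {t h v z} → Consistent t h → toℕ v ≡ t → Even (z - colour v) →
                        (∀ {x e} → x F.< v → e ∈ Λ x v → h x - z ≤ e) →
                        (∀ {x e} → x F.< v → e ∈ Λ x v → z - h x ≤ e) →
                        Consistent (suc t) (h [ v ↦ z ])
    consistent-extend {t} {h} {v} {z} inv v≡t z-parity high-enough low-enough =
      record { parity = parity′ ; close = close′ }
      where
      open Consistent inv
      below-v : ∀ {x : V} → toℕ x ℕ.< suc t → x ≢ v → x F.< v
      below-v {x} x<1+t x≢v = subst (toℕ x ℕ.<_) (sym v≡t) (below-next v≡t x<1+t x≢v)
      parity′ : ∀ x → toℕ x ℕ.< suc t → Even ((h [ v ↦ z ]) x - colour x)
      parity′ x x<1+t with x ≟ v
      ... | yes refl = z-parity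
      ... | no x≢v   = parity x (below-next v≡t x<1+t x≢v)
      close′ : ∀ x y {e} → toℕ x ℕ.< suc t → toℕ y ℕ.< suc t → e ∈ Λ x y →
               (h [ v ↦ z ]) x - (h [ v ↦ z ]) y ≤ e
      close′ x y x<1+t y<1+t e∈ with x ≟ v | y ≟ v
      ... | yes refl | yes refl = ⊥-elim (Λ-irreflexive v e∈)
      ... | yes refl | no y≢v   = low-enough (below-v y<1+t y≢v) (Λ-sym v y e∈)
      ... | no x≢v   | yes refl = high-enough (below-v x<1+t x≢v) e∈
      ... | no x≢v   | no y≢v   = close x y (below-next v≡t x<1+t x≢v) (below-next v≡t y<1+t y≢v) e∈

    module Offer {t h v z} (inv : Consistent t h) (v≡t : toℕ v ≡ t) (z∈ : z ∈ strategy v h) where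
      open Consistent inv

      earlier : ∀ {x : V} → x F.< v → toℕ x ℕ.< t
      earlier {x} = subst (toℕ x ℕ.<_) v≡t

      start≤z : start v h ≤ z
      start≤z = proj₁ (offered {v} {h} z∈)

      z≤start+weight : z ≤ start v h + weight v
      z≤start+weight = proj₁ (proj₂ (offered {v} {h} z∈))

      start-parity : Even (start v h - colour v)
      start-parity = maxOr-all (subst Even (sym (ℤP.+-inverseʳ (colour v))) even-0)
                               (All.tabulate bound-parity)
        where
        bound-parity : ∀ {l} → l ∈ lowerBounds v h → Even (l - colour v)
        bound-parity l∈ with ∈-lowerBounds⁻ {v} {h} l∈
        ... | y , e , y<v , e∈ , refl = subst Even
          (((∀ hy cy cv e → hy - cy - (cy + cv + e) + (cy + cy) ≡ hy - e - cv) ∋ solve-∀)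
             (h y) (colour y) (colour v) e)
          (∣m∣n⇒∣m+n (∣m∣n⇒∣m-n (parity y (earlier y<v)) (Λ-parity y v e∈)) (even-double (colour y)))

      z-parity : Even (z - colour v)
      z-parity = subst Even (((∀ z s c → z - s + (s - c) ≡ z - c) ∋ solve-∀) z (start v h) (colour v))
                   (∣m∣n⇒∣m+n (proj₂ (proj₂ (offered {v} {h} z∈))) start-parity)

      high-enough : ∀ {x e} → x F.< v → e ∈ Λ x v → h x - z ≤ e
      high-enough {x} {e} x<v e∈ = ≤-by-slack (gap (≤-maxOr (∈-lowerBounds⁺ {h = h} x<v e∈)) ⊕ gap start≤z)
        (((∀ hx e s z → s - (hx - e) + (z - s) ≡ e - (hx - z)) ∋ solve-∀) (h x) e (start v h) z)

      -- Along the looping walk y … v … x, or from the absence of bad walks when y = x.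
      through-v : ∀ {x y e e′} → x F.< v → y F.< v → e ∈ Λ x v → e′ ∈ Λ y v → h y - h x ≤ e′ + e - weight v
      through-v {x} {y} {e} {e′} x<v y<v e∈ e′∈ with y ≟ x
      ... | yes refl = ≤-by-slack (gap (weight≤Λ+Λ x<v x<v e∈ e′∈))
        (((∀ hx e e′ w → e + e′ - w ≡ e′ + e - w - (hx - hx)) ∋ solve-∀) (h x) e e′ (weight v))
      ... | no y≢x = close y x (earlier y<v) (earlier x<v) (Λ-join y≢x (y<v , x<v) e′∈ (Λ-sym x v e∈))

      low-enough : ∀ {x e} → x F.< v → e ∈ Λ x v → z - h x ≤ e
      low-enough {x} {e} x<v e∈ with ∈-lowerBounds⁻ {v} {h} (maxOr-∈ {colour v} (∈-lowerBounds⁺ {h = h} x<v e∈))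
      ... | y , e′ , y<v , e′∈ , start≡ = ≤-by-slack (gap z≤ ⊕ gap (through-v x<v y<v e∈ e′∈))
        (((∀ hx hy e e′ w z → hy - e′ + w - z + (e′ + e - w - (hy - hx)) ≡ e - (z - hx)) ∋ solve-∀)
           (h x) (h y) e e′ (weight v) z)
        where
        z≤ : z ≤ h y - e′ + weight v
        z≤ = subst (λ s → z ≤ s + weight v) start≡ z≤start+weight

    consistent-play : ∀ {t vs f g} → Consistent t f → Suffix t vs → Play strategy vs f g → Consistent n g
    consistent-play inv []              done            = inv
    consistent-play inv (v≡t ∷ suffix) (step z∈ play) =
      consistent-play (consistent-extend inv v≡t z-parity high-enough low-enough) suffix play
      where open Offer inv v≡t z∈

    consistent⇒deltaCond : ∀ {g} → Consistent n g → DeltaCond g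
    consistent⇒deltaCond {g} inv u w d isδ =
      bounded⇒∣-∣≤ {d} {g u} {g w} (bounded (close u w (FP.toℕ<n u) (FP.toℕ<n w) d∈)
                                            (close w u (FP.toℕ<n w) (FP.toℕ<n u) (Λ-sym u w d∈))) ,
      ∣⇒∣ᵤ (subst Even
        (((∀ gu gw cu cw d → gu - cu + (gw - cw) + (cu + cw + d) ≡ gu + gw + d) ∋ solve-∀)
           (g u) (g w) (colour u) (colour w) d)
        (∣m∣n⇒∣m+n (∣m∣n⇒∣m+n (parity u (FP.toℕ<n u)) (parity w (FP.toℕ<n w))) (Λ-parity u w d∈)))
      where
      open Consistent inv
      d∈ : d ∈ Λ u w
      d∈ = isDelta⇒∈Λ isδ

    noBadWalk⇒proverEnsures : ProverCanEnsure DeltaCond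
    noBadWalk⇒proverEnsures = strategy , strategy-legal ,
      λ g play → consistent⇒deltaCond (consistent-play initial vars-suffix play)
      where
      initial : Consistent 0 f₀
      initial = record { parity = λ _ () ; close = λ _ _ () }

module AdversaryStrategy (n : ℕ) (atoms : List (Fin n × Fin n)) (β : Fin n → ℕ)
                         (β-1or2 : ∀ v → (β v ≡ 1) ⊎ (β v ≡ 2)) where
  open Instance n atoms β
  open LoopingWalks n atoms β
  open Plays n atoms β

  β-nonzero : ∀ v → 0 ≢ β v
  β-nonzero v 0≡β with β-1or2 v
  ... | inj₁ β≡1 = ℕP.0≢1+n (trans 0≡β β≡1)
  ... | inj₂ β≡2 = ℕP.0≢1+n (trans 0≡β β≡2)

  Bad : V → (V → ℤ) → ℤ → Set
  Bad v h z = Σ[ x ∈ V ] (x F.< v) × Any (λ e → ¬ Compatible e z (h x)) (Λ x v)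

  bad? : ∀ v h → Decidable (Bad v h)
  bad? v h z = FP.any? (λ x → (x F.<? v) ×-dec Any.any? (λ e → ¬? (compatible? e z (h x))) (Λ x v))

  bad-cong : ∀ {v g f z} → (∀ x → x F.< v → g x ≡ f x) → Bad v g z → Bad v f z
  bad-cong {v} {z = z} g≗f (x , x<v , bad) =
    x , x<v , subst (λ hx → Any (λ e → ¬ Compatible e z hx) (Λ x v)) (g≗f x x<v) bad

  record Answer (v : V) (g : V → ℤ) (zs : List ℤ) : Set where
    field
      length-offer : length zs ≡ β v
      unique-offer : Unique zs
      chosen       : g v ∈ zs
      bad-chosen   : Any (Bad v g) zs → Bad v g (g v)

  record Outcome (t : ℕ) (f : V → ℤ) : Set where
    field
      g       : V → ℤ
      offer   : V → List ℤ
      hom     : Hom g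
      agrees  : ∀ w → toℕ w ℕ.< t → g w ≡ f w
      answers : ∀ v → t ℕ.≤ toℕ v → Answer v g (offer v)

  adversary-outcome : ∀ {t vs f} → Suffix t vs → Sat vs f → Outcome t f
  adversary-outcome {f = f} [] hom = record
    { g = f ; offer = λ _ → [] ; hom = hom ; agrees = λ _ _ → refl
    ; answers = λ v n≤v → ⊥-elim (ℕP.<-irrefl refl (ℕP.<-≤-trans (FP.toℕ<n v) n≤v)) }
  adversary-outcome {t} {v ∷ vs} (_ ∷ _) ([] , 0≡β , _ , _) = ⊥-elim (β-nonzero v 0≡β)
  adversary-outcome {t} {v ∷ vs} {f} (v≡t ∷ suffix) (z₀ ∷ zs , length≡ , unique , sats)
    with prefer (bad? v f) z₀ zs
  ... | z , z∈ , prefer-bad = record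
    { g = g ; offer = offer′ ; hom = hom ; agrees = agrees′ ; answers = answers′ }
    where
    open Outcome (adversary-outcome suffix (All.lookup sats z∈))
    v<1+t : toℕ v ℕ.< suc t
    v<1+t = subst (ℕ._< suc t) (sym v≡t) (ℕP.n<1+n t)
    agrees′ : ∀ w → toℕ w ℕ.< t → g w ≡ f w
    agrees′ w w<t = trans (agrees w (ℕP.m<n⇒m<1+n w<t)) (update-≢ f z (λ { refl → ℕP.<-irrefl v≡t w<t }))
    g≗f : ∀ x → x F.< v → g x ≡ f x
    g≗f x x<v = agrees′ x (subst (toℕ x ℕ.<_) v≡t x<v)
    offer′ : V → List ℤ
    offer′ w with w ≟ v
    ... | yes _ = z₀ ∷ zs
    ... | no _  = offer w
    answers′ : ∀ w → t ℕ.≤ toℕ w → Answer w g (offer′ w)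
    answers′ w t≤w with w ≟ v
    ... | yes refl = record
      { length-offer = length≡ ; unique-offer = unique
      ; chosen = subst (_∈ z₀ ∷ zs) (sym gv≡z) z∈
      ; bad-chosen = λ some → subst (Bad v g) (sym gv≡z)
          (bad-cong (λ x x<v → sym (g≗f x x<v)) (prefer-bad (Any.map (bad-cong g≗f) some))) }
      where
      gv≡z : g v ≡ z
      gv≡z = trans (agrees v v<1+t) (update-≡ f v z)
    ... | no w≢v with ℕP.m≤n⇒m<n∨m≡n t≤w
    ...   | inj₁ t<w = answers w t<w
    ...   | inj₂ t≡w = ⊥-elim (w≢v (FP.toℕ-injective (trans (sym t≡w) (sym v≡t))))

  module Compatibility {g : V → ℤ} {offer : V → List ℤ}
                       (hom : Hom g) (answers : ∀ v → Answer v g (offer v)) where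

    CompatibleInto : V → Set
    CompatibleInto m = ∀ x is → Looping x is m → Compatible (λw is) (g x) (g m)

    -- g m is not bad when every looping walk into m is compatible, so no bad value was offered at m.
    offered-compatible : ∀ {m z x e} → CompatibleInto m → z ∈ offer m → x F.< m → e ∈ Λ x m →
                         Compatible e z (g x)
    offered-compatible {m} {z} {x} {e} into z∈ x<m e∈ with compatible? e z (g x)
    ... | yes ok = ok
    ... | no incompatible with Answer.bad-chosen (answers m) (lose z∈ (x , x<m , lose e∈ incompatible))
    ...   | y , _ , bad with find bad
    ...     | _ , e′∈ , incompatible′ with Λ-sound y m e′∈
    ...       | is , L , refl = ⊥-elim (incompatible′ (compatible-sym (into y is L)))

    two-offers : ∀ {m} → β m ≡ 2 → Σ[ z₁ ∈ ℤ ] Σ[ z₂ ∈ ℤ ] (z₁ ∈ offer m) × (z₂ ∈ offer m) × (z₁ ≢ z₂)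
    two-offers {m} β≡2 = two-distinct (offer m) (trans length-offer β≡2) unique-offer
      where open Answer (answers m)

    edge-compatible : ∀ {a b} → Adj a b → Compatible (+ 1) (g a) (g b)
    edge-compatible (inj₁ ab) = ∣-∣≡1⇒compatible (hom ab)
    edge-compatible (inj₂ ba) = compatible-sym (∣-∣≡1⇒compatible (hom ba))

    walks-compatible : ∀ j {a is b} → Looping a is b → Fuel j a b → Compatible (λw is) (g a) (g b)
    walks-compatible j (edge _ ab) _ = edge-compatible ab
    walks-compatible j {a} {_} {b} (comb {m = m} {ys} {zs} _ int L₁ L₂) fuel
      with splitting-vertex-above ys int
    ... | a<m , b<m with fuel-split fuel (a<m , b<m)
    ... | j′ , refl , fuel′ =
      subst (λ l → Compatible l (g a) (g b)) (sym (λw-++ ys m zs)) (compatible (bounds (β-1or2 m)) parity)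
      where
      into-m : CompatibleInto m
      into-m x is L = walks-compatible j′ L (inj₂ fuel′)
      c₁ : Compatible (λw ys) (g a) (g m)
      c₁ = into-m a ys L₁
      c₂ : Compatible (λw zs) (g m) (g b)
      c₂ = walks-compatible j′ L₂ (inj₁ fuel′)
      parity : Even (g a + g b + (λw ys + λw zs - weight m))
      parity = even-join {g a} {g m} {g b} (Compatible.even c₁) (Compatible.even c₂) (even-2* (β m ∸ 1))
      weight≡ : ∀ {k} → β m ≡ suc k → weight m ≡ + (2 ℕ.* k)
      weight≡ β≡1+k = cong (λ k → + (2 ℕ.* (k ∸ 1))) β≡1+k
      bounds : (β m ≡ 1) ⊎ (β m ≡ 2) → Bounded (λw ys + λw zs - weight m) (g a) (g b)
      bounds (inj₁ β≡1) =
        subst (λ w → Bounded (λw ys + λw zs - w) (g a) (g b)) (sym (weight≡ β≡1))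
          (subst (λ l → Bounded l (g a) (g b)) (sym (ℤP.+-identityʳ _))
                 (bounded-trans (Compatible.bounds c₁) (Compatible.bounds c₂)))
      bounds (inj₂ β≡2) with two-offers β≡2
      ... | z₁ , z₂ , z₁∈ , z₂∈ , z₁≢z₂ =
        subst (λ w → Bounded (λw ys + λw zs - w) (g a) (g b)) (sym (weight≡ β≡2))
          (bounded-via-distinct-midpoints (compatible-sym (at-a z₁∈)) (compatible-sym (at-a z₂∈))
                                          (Compatible.bounds (at-b z₁∈)) (Compatible.bounds (at-b z₂∈)) z₁≢z₂)
        where
        at-a : ∀ {z} → z ∈ offer m → Compatible (λw ys) z (g a)
        at-a z∈ = offered-compatible into-m z∈ a<m (proj₁ (Λ-complete L₁))
        at-b : ∀ {z} → z ∈ offer m → Compatible (λw zs) z (g b)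
        at-b z∈ = offered-compatible into-m z∈ b<m (proj₂ (Λ-complete L₂))

  models⇒noBadWalk : Models → ¬ BadWalk
  models⇒noBadWalk models (a , is , b , L , a<b , λ≤) = impossible (β-1or2 b)
    where
    open Outcome (adversary-outcome vars-suffix models)
    open Compatibility hom (λ v → answers v ℕ.z≤n)
    into-b : CompatibleInto b
    into-b x is L = walks-compatible n L (inj₂ (ℕP.m≤n+m n (suc (toℕ b))))
    impossible : (β b ≡ 1) ⊎ (β b ≡ 2) → ⊥
    impossible (inj₁ β≡1)
      with ℤP.≤-trans (bounded-nonneg (Compatible.bounds (into-b a is L)))
                      (subst (λ k → λw is ≤ + k - + 2) β≡1 λ≤)
    ... | ()
    impossible (inj₂ β≡2) with two-offers β≡2
    ... | z₁ , z₂ , z₁∈ , z₂∈ , z₁≢z₂ = z₁≢z₂ (trans (≡ga z₁∈) (sym (≡ga z₂∈)))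
      where
      ≡ga : ∀ {z} → z ∈ offer b → z ≡ g a
      ≡ga z∈ = bounded-nonpos⇒≡ (Compatible.bounds (offered-compatible into-b z∈ a<b (proj₁ (Λ-complete L))))
                                (subst (λ k → λw is ≤ + k - + 2) β≡2 λ≤)

1or2⇒positive : ∀ {b} → (b ≡ 1) ⊎ (b ≡ 2) → 1 ℕ.≤ b
1or2⇒positive (inj₁ refl) = ℕ.s≤s ℕ.z≤n
1or2⇒positive (inj₂ refl) = ℕ.s≤s ℕ.z≤n

theorem19 : (n : ℕ) (atoms : List (Fin n × Fin n)) (β : Fin n → ℕ) →
  (∀ v → (β v ≡ 1) ⊎ (β v ≡ 2)) →
  Bipartite n atoms →
  (Instance.Models n atoms β ⇔ Instance.ProverWins n atoms β)
  × (Instance.ProverWins n atoms β ⇔ Instance.ProverCanEnsure n atoms β (Instance.DeltaCond n atoms β))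
  × (Instance.ProverCanEnsure n atoms β (Instance.DeltaCond n atoms β) ⇔ Instance.NoSmallDelta n atoms β)
  × (Instance.NoSmallDelta n atoms β ⇔ (¬ Instance.BadWalk n atoms β))
theorem19 n atoms β β-1or2 bipartite =
  mk⇔ (proverEnsures⇒proverWins ∘ noBadWalk⇒proverEnsures ∘ models⇒noBadWalk) proverWins⇒models ,
  mk⇔ (noBadWalk⇒proverEnsures ∘ models⇒noBadWalk ∘ proverWins⇒models) proverEnsures⇒proverWins ,
  mk⇔ (noBadWalk⇒noSmallDelta ∘ models⇒noBadWalk ∘ proverWins⇒models ∘ proverEnsures⇒proverWins)
      (noBadWalk⇒proverEnsures ∘ noSmallDelta⇒noBadWalk) ,
  noSmallDelta⇔noBadWalk
  where
  open LoopingWalks n atoms β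
  open Plays n atoms β
  open ProverStrategy n atoms β (1or2⇒positive ∘ β-1or2) bipartite
  open AdversaryStrategy n atoms β β-1or2
  open Equivalence noSmallDelta⇔noBadWalk
    renaming (to to noSmallDelta⇒noBadWalk; from to noBadWalk⇒noSmallDelta)
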